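{- Let $n\ge 2$ and let $G\in\mathcal{G}(n)$. For $1\le i\le n-1$ let $W_i=r_{i+1}\cup c_i$. For any set $X\subseteq W_i$, the number of pairs $(u,v)$ with $u\in X\cap r_{i+1}$ and $v\in X\cap c_i$ that interact is at most $\min\{|X|^2/4,\ i(n-i)\}\le n^2/4$; moreover, distinct interacting pairs $(u,v)$ with $u\in r_{i+1}$, $v\in c_i$ are the predecessors of distinct $L$-vertices, each belonging to a distinct $R$-vertex.
   Context: A CDAG (computational directed acyclic graph) is a DAG whose vertices represent input values or results of operations and whose edges represent data dependencies. For a positive integer $n$, the family $\mathcal{G}(n)$ consists of all CDAGs built as follows. There are $R$-vertices $v_{i,j}$ for all $1\le i\le j\le n$; the vertices $v_{i,i}$ are the input vertices. For every pair $i<j$ the CDAG contains a directed binary tree with exactly $j-i$ leaves, all of whose edges are directed towards its root $v_{i,j}$; the shape of each tree is arbitrary and the trees for distinct pairs $(i,j)$ are vertex-disjoint. The leaves of the tree rooted at $v_{i,j}$ are called the $L$-vertices belonging to $v_{i,j}$; for $k\in\{0,\dots,j-i-1\}$ the $k$-th leaf has exactly two predecessors, namely $v_{i,i+k}$ and $v_{i+k+1,j}$. Two $R$-vertices interact if they are the two predecessors of a common $L$-vertex. The $i$-th row is $r_i=\{v_{i,j}: i\le j\le n\}$ and the $j$-th column is $c_j=\{v_{i,j}:1\le i\le j\}$. -}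

module Defs where

open import Data.Nat using (ℕ; zero; suc; _+_; _*_; _∸_; _≤_; _<_)
open import Data.Product using (Σ; _×_; _,_; proj₁; proj₂)
open import Data.Sum using (_⊎_)
open import Relation.Binary.PropositionalEquality using (_≡_)

-- An R-vertex v_{a,b} is represented by the pair (a , b) of naturals.
RVert : Set
RVert = ℕ × ℕ

IsR : ℕ → RVert → Set
IsR n (a , b) = 1 ≤ a × a ≤ b × b ≤ n

InRow : ℕ → ℕ → RVert → Set
InRow n r w = IsR n w × proj₁ w ≡ r

InCol : ℕ → ℕ → RVert → Set
InCol n c w = IsR n w × proj₂ w ≡ c

InW : ℕ → ℕ → RVert → Set
InW n i w = InRow n (suc i) w ⊎ InCol n i w

data Tree : ℕ → Set where
  leaf : Tree 1
  node : ∀ {p q} → Tree p → Tree q → Tree (p + q)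

data Leaf : ∀ {m} → Tree m → Set where
  here  : Leaf leaf
  left  : ∀ {p q} {s : Tree p} {t : Tree q} → Leaf s → Leaf (node s t)
  right : ∀ {p q} {s : Tree p} {t : Tree q} → Leaf t → Leaf (node s t)

leafIdx : ∀ {m} {t : Tree m} → Leaf t → ℕ
leafIdx here = 0
leafIdx (left x) = leafIdx x
leafIdx (right {p = p} x) = p + leafIdx x

-- A CDAG G ∈ 𝒢(n): for each pair 1 ≤ a < b ≤ n a binary tree with b - a
-- leaves rooted at v_{a,b}.  (Trees for distinct pairs are disjoint by
-- construction.)
CDAG : ℕ → Set
CDAG n = (a b : ℕ) → 1 ≤ a → a < b → b ≤ n → Tree (b ∸ a)

record LVertex {n : ℕ} (G : CDAG n) : Set where
  constructor lv
  field
    a    : ℕ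
    b    : ℕ
    1≤a  : 1 ≤ a
    a<b  : a < b
    b≤n  : b ≤ n
    lf   : Leaf (G a b 1≤a a<b b≤n)

module _ {n : ℕ} {G : CDAG n} where
  open LVertex

  owner : LVertex G → RVert
  owner ℓ = (a ℓ , b ℓ)

  pred₁ : LVertex G → RVert
  pred₁ ℓ = (a ℓ , a ℓ + leafIdx (lf ℓ))

  pred₂ : LVertex G → RVert
  pred₂ ℓ = (suc (a ℓ + leafIdx (lf ℓ)) , b ℓ)

PredsOf : ∀ {n} {G : CDAG n} → LVertex G → RVert → RVert → Set
PredsOf ℓ u v = (pred₁ ℓ ≡ u × pred₂ ℓ ≡ v) ⊎ (pred₁ ℓ ≡ v × pred₂ ℓ ≡ u)

Interact : ∀ {n} → CDAG n → RVert → RVert → Set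
Interact G u v = Σ (LVertex G) (λ ℓ → PredsOf ℓ u v)

{-# OPTIONS --safe #-}
module Submission where

-- An interacting pair u = v_{i+1,b} ∈ r_{i+1}, v = v_{a,i} ∈ c_i must be the
-- predecessor pair (v_{a,i} , v_{i+1,b}) of a leaf of v_{a,b}: the other order would
-- make the owner v_{i+1,i}.  So the owner determines the pair.  For counting, the
-- pairs lie in (X ∩ r_{i+1}) × (X ∩ c_i), of size at most |X|²/4 because rows and
-- columns are disjoint and 4xy ≤ (x + y)², and in r_{i+1} × c_i, of size (n - i) i.

open import Defs
open import Data.Nat using (ℕ; suc; _+_; _*_; _∸_; _≤_; _<_; _≟_; z≤n; s≤s)
open import Data.Nat.Properties
open import Data.Nat.Solver using (module +-*-Solver)
open import Data.Empty using (⊥-elim)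
open import Data.Product using (Σ; _×_; _,_; proj₁; proj₂; uncurry)
open import Data.Product.Properties using (,-injective)
open import Function using (_∘′_)
open import Data.Sum using (inj₁; inj₂)
open import Data.List using (List; []; _∷_; length; map; _++_; filter; applyUpTo; cartesianProduct)
open import Data.List.Properties using (length-++; length-map; length-applyUpTo; length-removeAt′)
open import Data.List.Relation.Unary.All as All using (All)
open import Data.List.Relation.Unary.Any using (here; there; index; _─_)
open import Data.List.Relation.Unary.AllPairs using (_∷_)
open import Data.List.Relation.Unary.Unique.Propositional using (Unique)
open import Data.List.Membership.Propositional using (_∈_)
open import Data.List.Membership.Propositional.Properties
  using (∈-cartesianProduct⁺; ∈-applyUpTo⁺; ∈-filter⁺)
open import Data.List.Relation.Binary.Subset.Propositional using (_⊆_)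
open import Level using (0ℓ)
open import Relation.Nullary using (¬_; yes; no)
open import Relation.Unary using (Pred; Decidable)
open import Relation.Unary.Properties using (∁?)
open import Relation.Binary.PropositionalEquality
  using (_≡_; _≢_; refl; sym; trans; cong; cong₂; subst; subst₂; ≢-sym; module ≡-Reasoning)

module _ {A : Set} where

  ∈-─⁺ : ∀ {x y} {ys : List A} → x ∈ ys → x ≢ y → (y∈ys : y ∈ ys) → x ∈ (ys ─ y∈ys)
  ∈-─⁺ (here refl)  x≢y (here refl)  = ⊥-elim (x≢y refl)
  ∈-─⁺ (there x∈ys) _   (here refl)  = x∈ys
  ∈-─⁺ (here x≡z)   _   (there _)    = here x≡z
  ∈-─⁺ (there x∈ys) x≢y (there y∈ys) = there (∈-─⁺ x∈ys x≢y y∈ys)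

  unique-⊆⇒length≤ : ∀ {xs ys : List A} → Unique xs → xs ⊆ ys → length xs ≤ length ys
  unique-⊆⇒length≤ {[]}     _                 _     = z≤n
  unique-⊆⇒length≤ {x ∷ xs} {ys} (x∉xs ∷ unique) xs⊆ys =
    subst (suc (length xs) ≤_) (sym (length-removeAt′ ys (index x∈ys)))
      (s≤s (unique-⊆⇒length≤ unique xs⊆ys─x))
    where
    x∈ys : x ∈ ys
    x∈ys = xs⊆ys (here refl)

    xs⊆ys─x : xs ⊆ (ys ─ x∈ys)
    xs⊆ys─x z∈xs = ∈-─⁺ (xs⊆ys (there z∈xs)) (≢-sym (All.lookup x∉xs z∈xs)) x∈ys

module _ {A B : Set} where

  length-cartesianProduct : (xs : List A) (ys : List B) →
                            length (cartesianProduct xs ys) ≡ length xs * length ys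
  length-cartesianProduct []       ys = refl
  length-cartesianProduct (x ∷ xs) ys = begin
    length (map (x ,_) ys ++ cartesianProduct xs ys)         ≡⟨ length-++ (map (x ,_) ys) ⟩
    length (map (x ,_) ys) + length (cartesianProduct xs ys) ≡⟨ cong₂ _+_ (length-map (x ,_) ys)
                                                                          (length-cartesianProduct xs ys) ⟩
    length ys + length xs * length ys                        ∎
    where open ≡-Reasoning

  unique-⊆-cartesianProduct⇒length≤ :
    ∀ {ps : List (A × B)} (xs : List A) (ys : List B) → Unique ps →
    (∀ {x y} → (x , y) ∈ ps → x ∈ xs × y ∈ ys) → length ps ≤ length xs * length ys
  unique-⊆-cartesianProduct⇒length≤ xs ys unique ps⊆xs×ys =
    subst (_ ≤_) (length-cartesianProduct xs ys)
      (unique-⊆⇒length≤ unique (uncurry ∈-cartesianProduct⁺ ∘′ ps⊆xs×ys))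

module _ {A : Set} {Q : Pred A 0ℓ} (Q? : Decidable Q) where

  length-filter+length-filter-∁ : ∀ xs →
    length (filter Q? xs) + length (filter (∁? Q?) xs) ≡ length xs
  length-filter+length-filter-∁ []       = refl
  length-filter+length-filter-∁ (x ∷ xs) with Q? x
  ... | yes _ = cong suc (length-filter+length-filter-∁ xs)
  ... | no  _ = trans (+-suc _ _) (cong suc (length-filter+length-filter-∁ xs))

m≤n⇒4[m*n]≤[m+n]² : ∀ {m n} → m ≤ n → 4 * (m * n) ≤ (m + n) * (m + n)
m≤n⇒4[m*n]≤[m+n]² {m} m≤n with d , refl ← m≤n⇒∃[o]m+o≡n m≤n =
  subst (4 * (m * (m + d)) ≤_) square-of-sum (m≤m+n _ (d * d))
  where
  open +-*-Solver
  square-of-sum : 4 * (m * (m + d)) + d * d ≡ (m + (m + d)) * (m + (m + d))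
  square-of-sum = solve 2 (λ m d → con 4 :* (m :* (m :+ d)) :+ d :* d
                                  := (m :+ (m :+ d)) :* (m :+ (m :+ d))) refl m d

4[m*n]≤[m+n]² : ∀ m n → 4 * (m * n) ≤ (m + n) * (m + n)
4[m*n]≤[m+n]² m n with ≤-total m n
... | inj₁ m≤n = m≤n⇒4[m*n]≤[m+n]² m≤n
... | inj₂ n≤m = subst₂ _≤_ (cong (4 *_) (*-comm n m)) (cong (λ s → s * s) (+-comm n m))
                   (m≤n⇒4[m*n]≤[m+n]² n≤m)

module _ {A : Set} {Q : Pred A 0ℓ} (Q? : Decidable Q) where

  crossing-pairs-4*length≤length² :
    ∀ {xs : List A} {ps : List (A × A)} → Unique ps →
    (∀ {x y} → (x , y) ∈ ps → (x ∈ xs × Q x) × (y ∈ xs × ¬ Q y)) →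
    4 * length ps ≤ length xs * length xs
  crossing-pairs-4*length≤length² {xs} {ps} unique crossing = begin
    4 * length ps                 ≤⟨ *-monoʳ-≤ 4 (unique-⊆-cartesianProduct⇒length≤ inside outside unique split) ⟩
    4 * (length inside * length outside)
                                  ≤⟨ 4[m*n]≤[m+n]² (length inside) (length outside) ⟩
    (length inside + length outside) * (length inside + length outside)
                                  ≡⟨ cong (λ s → s * s) (length-filter+length-filter-∁ Q? xs) ⟩
    length xs * length xs         ∎
    where
    open ≤-Reasoning
    inside outside : List A
    inside  = filter Q? xs
    outside = filter (∁? Q?) xs

    split : ∀ {x y} → (x , y) ∈ ps → x ∈ inside × y ∈ outside
    split p∈ with (x∈xs , Qx) , (y∈xs , ¬Qy) ← crossing p∈ =
      ∈-filter⁺ Q? x∈xs Qx , ∈-filter⁺ (∁? Q?) y∈xs ¬Qy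

row : ℕ → ℕ → List RVert
row n r = applyUpTo (λ k → (r , r + k)) (suc n ∸ r)

column : ℕ → List RVert
column c = applyUpTo (λ k → (suc k , c)) c

∈-row : ∀ {n r u} → InRow n r u → u ∈ row n r
∈-row {n} {r} {_ , b} ((_ , r≤b , b≤n) , refl) =
  subst (λ j → (r , j) ∈ row n r) (m+[n∸m]≡n r≤b)
    (∈-applyUpTo⁺ (λ k → (r , r + k)) (∸-monoˡ-< (s≤s b≤n) r≤b))

∈-column : ∀ {n c v} → InCol n c v → v ∈ column c
∈-column {v = suc k , _} ((_ , k<c , _) , refl) = ∈-applyUpTo⁺ (λ k → (suc k , _)) k<c

column∌row : ∀ {n i v} → InCol n i v → proj₁ v ≢ suc i
column∌row ((_ , a≤i , _) , refl) refl = <-irrefl refl a≤i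

owner-of-preds : ∀ {n} {G : CDAG n} (ℓ : LVertex G) {u v} → PredsOf ℓ u v →
                 proj₂ v < proj₁ u → owner ℓ ≡ (proj₁ v , proj₂ u)
owner-of-preds (lv _ _ _ a<b _ _) (inj₁ (refl , refl)) b<a = ⊥-elim (<-asym a<b b<a)
owner-of-preds _                  (inj₂ (refl , refl)) _   = refl

owner-determines-row-column-preds :
  ∀ {n i} {G : CDAG n} {u v u′ v′} →
  InRow n (suc i) u → InCol n i v → InRow n (suc i) u′ → InCol n i v′ →
  (ℓ ℓ′ : LVertex G) → PredsOf ℓ u v → PredsOf ℓ′ u′ v′ →
  owner ℓ ≡ owner ℓ′ → (u , v) ≡ (u′ , v′)
owner-determines-row-column-preds {i = i} (_ , refl) (_ , refl) (_ , refl) (_ , refl)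
  ℓ ℓ′ preds preds′ same-owner
  with refl , refl ← ,-injective (trans (sym (owner-of-preds ℓ preds (n<1+n i)))
                                  (trans same-owner (owner-of-preds ℓ′ preds′ (n<1+n i)))) = refl

module _ {n : ℕ} (G : CDAG n) (i : ℕ) where

  RowColumnInteraction : List RVert → Pred (RVert × RVert) 0ℓ
  RowColumnInteraction X p = Σ RVert λ u → Σ RVert λ v → p ≡ (u , v) ×
    u ∈ X × InRow n (suc i) u × v ∈ X × InCol n i v × Interact G u v

  module _ {X : List RVert} {P : List (RVert × RVert)}
           (interactions : All (RowColumnInteraction X) P) where

    row-column-components : ∀ {u v} → (u , v) ∈ P →
                            (u ∈ X × InRow n (suc i) u) × (v ∈ X × InCol n i v)
    row-column-components p∈P with All.lookup interactions p∈P
    ... | _ , _ , refl , u∈X , u∈row , v∈X , v∈col , _ = (u∈X , u∈row) , (v∈X , v∈col)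

    row-column-interactions-4*length≤length² : Unique P → 4 * length P ≤ length X * length X
    row-column-interactions-4*length≤length² unique =
      crossing-pairs-4*length≤length² (λ u → proj₁ u ≟ suc i) unique λ p∈P →
        let (u∈X , _ , first≡) , (v∈X , v∈col) = row-column-components p∈P
        in  (u∈X , first≡) , (v∈X , column∌row v∈col)

    row-column-interactions≤i*[n∸i] : Unique P → length P ≤ i * (n ∸ i)
    row-column-interactions≤i*[n∸i] unique =
      subst (length P ≤_) |row|*|column|≡i*[n∸i]
        (unique-⊆-cartesianProduct⇒length≤ (row n (suc i)) (column i) unique λ p∈P →
          let (_ , u∈row) , (_ , v∈col) = row-column-components p∈P
          in  ∈-row u∈row , ∈-column v∈col)
      where
      |row|*|column|≡i*[n∸i] : length (row n (suc i)) * length (column i) ≡ i * (n ∸ i)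
      |row|*|column|≡i*[n∸i] = trans (cong₂ _*_ (length-applyUpTo _ (n ∸ i)) (length-applyUpTo _ i))
                                     (*-comm (n ∸ i) i)

lemma1 : (n : ℕ) → 2 ≤ n → (G : CDAG n) → (i : ℕ) → 1 ≤ i → i ≤ n ∸ 1 →
    ((X : List RVert) → Unique X → All (InW n i) X →
      (P : List (RVert × RVert)) → Unique P →
      All (λ p → Σ RVert λ u → Σ RVert λ v → p ≡ (u , v) ×
             u ∈ X × InRow n (suc i) u × v ∈ X × InCol n i v × Interact G u v) P →
      4 * length P ≤ length X * length X × length P ≤ i * (n ∸ i))
    × 4 * (i * (n ∸ i)) ≤ n * n
    × ((u v u′ v′ : RVert) → InRow n (suc i) u → InCol n i v →
        InRow n (suc i) u′ → InCol n i v′ →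
        (ℓ ℓ′ : LVertex G) → PredsOf ℓ u v → PredsOf ℓ′ u′ v′ →
        (u , v) ≢ (u′ , v′) → owner ℓ ≢ owner ℓ′)
lemma1 n _ G i _ i≤n-1 =
  (λ X _ _ P unique interactions →
      row-column-interactions-4*length≤length² G i interactions unique
    , row-column-interactions≤i*[n∸i] G i interactions unique)
  , subst (λ m → 4 * (i * (n ∸ i)) ≤ m * m) i+[n∸i]≡n (4[m*n]≤[m+n]² i (n ∸ i))
  , λ _ _ _ _ u∈row v∈col u′∈row v′∈col ℓ ℓ′ preds preds′ distinct same-owner →
      distinct (owner-determines-row-column-preds u∈row v∈col u′∈row v′∈col ℓ ℓ′ preds preds′ same-owner)
  where
  i+[n∸i]≡n : i + (n ∸ i) ≡ n
  i+[n∸i]≡n = m+[n∸m]≡n (≤-trans i≤n-1 (m∸n≤m n 1))
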